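{- Let $G$ be a locally linear graph and let $G^*$ be its triangle graph. Then the number of induced subgraphs of $G$ isomorphic to the cycle $C_4$ equals the number of induced subgraphs of $G^*$ isomorphic to $C_4$.
   Context: All graphs are finite, simple and undirected. A graph $G$ is locally linear if it has no isolated vertices and for every vertex $v$ the subgraph induced on its neighbourhood $N(v)=\{w\in V(G): w\sim v, w\neq v\}$ is $1$-regular; equivalently, every edge of $G$ lies in exactly one triangle (so two distinct triangles of $G$ share at most one vertex). The triangle graph $G^*$ of a locally linear graph $G$ is the graph whose vertex set is the set of triangles of $G$, two distinct triangles being adjacent in $G^*$ if and only if they share a common vertex in $G$. -}

module Defs where

open import Data.Bool using (Bool; true; false; _∧_; _∨_; not; if_then_else_)
open import Data.Nat using (ℕ; _<ᵇ_; _≡ᵇ_; _+_; _%_)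
open import Data.Fin using (Fin; toℕ; zero; suc)
open import Data.List using (List; []; _∷_; allFin; filterᵇ; concatMap; length; lookup)
open import Data.Bool.ListAction using (all; any)
open import Data.Product using (Σ; ∃; _×_; _,_)
open import Relation.Binary.PropositionalEquality using (_≡_)

record Graph : Set where
  field
    n     : ℕ
    adj   : Fin n → Fin n → Bool
    sym   : ∀ u v → adj u v ≡ adj v u
    irrefl : ∀ v → adj v v ≡ false
open Graph public

Adj : (G : Graph) → Fin (n G) → Fin (n G) → Set
Adj G u v = adj G u v ≡ true

-- Locally linear: no isolated vertices, and for every vertex v the
-- subgraph induced on N(v) is 1-regular, i.e. every w ∈ N(v) has exactly
-- one neighbour u lying in N(v).
LocallyLinear : Graph → Set
LocallyLinear G =
  (∀ v → ∃ λ w → Adj G v w) ×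
  (∀ v w → Adj G v w →
     Σ (Fin (n G)) λ u → (Adj G v u × Adj G w u) ×
       (∀ u′ → Adj G v u′ → Adj G w u′ → u′ ≡ u))

_<F_ : ∀ {m} → Fin m → Fin m → Bool
a <F b = toℕ a <ᵇ toℕ b

_==F_ : ∀ {m} → Fin m → Fin m → Bool
a ==F b = toℕ a ≡ᵇ toℕ b

Triple : Set → Set
Triple A = A × A × A

triangles : (G : Graph) → List (Triple (Fin (n G)))
triangles G =
  filterᵇ (λ { (a , b , c) → (a <F b) ∧ (b <F c) ∧ adj G a b ∧ adj G b c ∧ adj G a c })
    (concatMap (λ a → concatMap (λ b → Data.List.map (λ c → (a , b , c)) (allFin (n G)))
                                (allFin (n G)))
               (allFin (n G)))
  where import Data.List

shareVertex : ∀ {m} → Triple (Fin m) → Triple (Fin m) → Bool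
shareVertex (a , b , c) (a′ , b′ , c′) =
  any (λ x → any (λ y → x ==F y) (a′ ∷ b′ ∷ c′ ∷ [])) (a ∷ b ∷ c ∷ [])

sameTriple : ∀ {m} → Triple (Fin m) → Triple (Fin m) → Bool
sameTriple (a , b , c) (a′ , b′ , c′) = (a ==F a′) ∧ (b ==F b′) ∧ (c ==F c′)

-- The triangle graph G*: vertices are the triangles of G (indexed by
-- positions in the list 'triangles G'), two distinct triangles being
-- adjacent iff they share a vertex.
triangleAdj : (G : Graph) → Fin (length (triangles G)) → Fin (length (triangles G)) → Bool
triangleAdj G i j =
  not (i ==F j) ∧ shareVertex (lookup (triangles G) i) (lookup (triangles G) j)

-- A 4-vertex subset is listed once as a < b < c < d.
-- Its induced subgraph is isomorphic to C4 iff there is a bijection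
-- π : Fin 4 → Fin 4 such that for all i j, the vertices w (π i), w (π j)
-- are adjacent iff i, j are adjacent in the cycle 0-1-2-3-0.

c4adj : Fin 4 → Fin 4 → Bool
c4adj i j = ((toℕ i + 1) % 4 ≡ᵇ toℕ j) ∨ ((toℕ j + 1) % 4 ≡ᵇ toℕ i)

fin4 : List (Fin 4)
fin4 = allFin 4

maps4 : List (Fin 4 → Fin 4)
maps4 =
  concatMap (λ x0 → concatMap (λ x1 → concatMap (λ x2 → Data.List.map (λ x3 →
      (λ { zero → x0 ; (suc zero) → x1 ; (suc (suc zero)) → x2 ; (suc (suc (suc zero))) → x3 }))
    fin4) fin4) fin4) fin4
  where import Data.List

injective4 : (Fin 4 → Fin 4) → Bool
injective4 π = all (λ i → all (λ j → not (π i ==F π j) ∨ (i ==F j)) fin4) fin4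

perms4 : List (Fin 4 → Fin 4)
perms4 = filterᵇ injective4 maps4

isInducedC4 : ∀ {m} → (Fin m → Fin m → Bool) → (Fin 4 → Fin m) → Bool
isInducedC4 adj w =
  any (λ π → all (λ i → all (λ j → eqB (adj (w (π i)) (w (π j))) (c4adj i j)) fin4) fin4) perms4
  where
  eqB : Bool → Bool → Bool
  eqB true  b = b
  eqB false b = not b

quads : (m : ℕ) → List (Fin 4 → Fin m)
quads m =
  concatMap (λ a → concatMap (λ b → concatMap (λ c → Data.List.map (λ d →
      (λ { zero → a ; (suc zero) → b ; (suc (suc zero)) → c ; (suc (suc (suc zero))) → d }))
    (filterᵇ (c <F_) (allFin m))) (filterᵇ (b <F_) (allFin m))) (filterᵇ (a <F_) (allFin m))) (allFin m)
  where import Data.List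

numInducedC4 : (m : ℕ) → (Fin m → Fin m → Bool) → ℕ
numInducedC4 m adj = length (filterᵇ (isInducedC4 adj) (quads m))

{-# OPTIONS --safe #-}
module Submission where

-- Both counts are compared through directed induced 4-cycles: tuples (a, b, c, d) with
-- a ~ b ~ c ~ d ~ a, a ≁ c, b ≁ d, a ≠ c and b ≠ d.
--
-- In any graph an induced C₄ carries exactly 8 of them. To see this let S₄ act on 4-tuples:
-- a tuple of distinct vertices has exactly one sorting permutation, and a sorted 4-set has
-- 8 or 0 orderings that are directed 4-cycles according as it induces C₄ or not. Both facts
-- depend only on the order and adjacency pattern of four points, and are checked by evaluation.
--
-- In a locally linear graph every edge lies in exactly one triangle, and distinct triangles share
-- at most one vertex. So a directed induced 4-cycle (T₁, T₂, T₃, T₄) of triangles yields the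
-- directed induced 4-cycle (T₄ ∩ T₁, T₁ ∩ T₂, T₂ ∩ T₃, T₃ ∩ T₄) of G, a directed induced 4-cycle
-- (a, b, c, d) of G yields the triangles on ab, bc, cd and da, and these maps are mutually inverse.

open import Data.Bool using (Bool; true; false; _∧_; _∨_; not; if_then_else_)
open import Data.Bool.ListAction using (any)
open import Data.Bool.Properties using (not-¬)
import Data.Bool.Properties as Bool
open import Data.Empty using (⊥; ⊥-elim)
open import Data.Fin using (Fin; zero; suc; toℕ; #_; _<_; _≤_)
open import Data.Fin.Properties using (toℕ-injective; all?; _<?_; <-irrefl; <-asym; <-trans; <-cmp; <⇒≢; ≤-refl; ≤-antisym)
open import Data.List using (List; []; _∷_; _++_; map; concatMap; filterᵇ; length; allFin; lookup; cartesianProduct; cartesianProductWith; foldr; foldl)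
open import Data.List.Properties using (map-tabulate)
open import Data.Nat using (ℕ; zero; suc; _+_; _*_)
import Data.Nat.Properties as ℕ
open import Algebra.Properties.CommutativeSemigroup ℕ.+-commutativeSemigroup using () renaming (interchange to +-interchange)
open import Data.Product using (∃-syntax; _×_; _,_; proj₁; proj₂)
open import Data.Product.Properties using (,-injective)
open import Data.Sum using (_⊎_; inj₁; inj₂)
import Data.Vec as Vec
import Data.Vec.Properties as Vec
open import Function using (id; _∘_; flip; mk⇔)
open import Level using (Level; _⊔_)
open import Relation.Binary.Definitions using (DecidableEquality; Symmetric; tri<; tri≈; tri>)
open import Relation.Binary.PropositionalEquality using (_≡_; _≢_; refl; sym; trans; cong; cong₂; subst; module ≡-Reasoning)
open import Relation.Nullary using (¬_; Dec; yes; no; does)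
open import Relation.Nullary.Decidable using (map′; _×-dec_; _→-dec_; dec-true; dec-false; from-yes)

open import Defs hiding (sym)
import Defs

private
  variable
    ℓ ℓ′ : Level
    A B : Set ℓ
    m : ℕ

-- Sums over lists

[_] : Bool → ℕ
[ true ]  = 1
[ false ] = 0

infixr 7 _·_

_·_ : Bool → ℕ → ℕ
true  · k = k
false · k = 0

∑ : List A → (A → ℕ) → ℕ
∑ []       f = 0
∑ (x ∷ xs) f = f x + ∑ xs f

infix 5 ∑
syntax ∑ xs (λ x → e) = ∑[ x ∈ xs ] e

∑-cong : (xs : List A) {f g : A → ℕ} → (∀ x → f x ≡ g x) → ∑ xs f ≡ ∑ xs g
∑-cong []       f≗g = refl
∑-cong (x ∷ xs) f≗g = cong₂ _+_ (f≗g x) (∑-cong xs f≗g)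

∑-zero : (xs : List A) → ∑[ x ∈ xs ] 0 ≡ 0
∑-zero []       = refl
∑-zero (x ∷ xs) = ∑-zero xs

∑-++ : (xs ys : List A) (f : A → ℕ) → ∑ (xs ++ ys) f ≡ ∑ xs f + ∑ ys f
∑-++ []       ys f = refl
∑-++ (x ∷ xs) ys f = trans (cong (f x +_) (∑-++ xs ys f)) (sym (ℕ.+-assoc (f x) _ _))

∑-map : (g : A → B) (xs : List A) (f : B → ℕ) → ∑ (map g xs) f ≡ ∑[ x ∈ xs ] f (g x)
∑-map g []       f = refl
∑-map g (x ∷ xs) f = cong (f (g x) +_) (∑-map g xs f)

∑-concatMap : (g : A → List B) (xs : List A) (f : B → ℕ) →
              ∑ (concatMap g xs) f ≡ ∑[ x ∈ xs ] ∑ (g x) f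
∑-concatMap g []       f = refl
∑-concatMap g (x ∷ xs) f = trans (∑-++ (g x) _ f) (cong (∑ (g x) f +_) (∑-concatMap g xs f))

∑-cartesianProduct : (xs : List A) (ys : List B) (f : A × B → ℕ) →
                     ∑ (cartesianProduct xs ys) f ≡ ∑[ x ∈ xs ] ∑[ y ∈ ys ] f (x , y)
∑-cartesianProduct []       ys f = refl
∑-cartesianProduct (x ∷ xs) ys f =
  trans (∑-++ (map (x ,_) ys) _ f) (cong₂ _+_ (∑-map (x ,_) ys f) (∑-cartesianProduct xs ys f))

∑-filterᵇ : (P : A → Bool) (xs : List A) (f : A → ℕ) → ∑ (filterᵇ P xs) f ≡ ∑[ x ∈ xs ] P x · f x
∑-filterᵇ P []       f = refl
∑-filterᵇ P (x ∷ xs) f with P x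
... | true  = cong (f x +_) (∑-filterᵇ P xs f)
... | false = ∑-filterᵇ P xs f

length-filterᵇ : (P : A → Bool) (xs : List A) → length (filterᵇ P xs) ≡ ∑[ x ∈ xs ] [ P x ]
length-filterᵇ P []       = refl
length-filterᵇ P (x ∷ xs) with P x
... | true  = cong suc (length-filterᵇ P xs)
... | false = length-filterᵇ P xs

∑-+ : (xs : List A) (f g : A → ℕ) → ∑[ x ∈ xs ] (f x + g x) ≡ ∑ xs f + ∑ xs g
∑-+ []       f g = refl
∑-+ (x ∷ xs) f g = trans (cong (f x + g x +_) (∑-+ xs f g)) (+-interchange (f x) (g x) _ _)

∑-· : (b : Bool) (xs : List A) (f : A → ℕ) → ∑[ x ∈ xs ] b · f x ≡ b · ∑ xs f
∑-· true  xs f = refl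
∑-· false xs f = ∑-zero xs

∑-*ˡ : (k : ℕ) (xs : List A) (f : A → ℕ) → ∑[ x ∈ xs ] k * f x ≡ k * ∑ xs f
∑-*ˡ k []       f = sym (ℕ.*-zeroʳ k)
∑-*ˡ k (x ∷ xs) f = trans (cong (k * f x +_) (∑-*ˡ k xs f)) (sym (ℕ.*-distribˡ-+ k (f x) _))

∑-comm : (xs : List A) (ys : List B) (f : A → B → ℕ) →
         ∑[ x ∈ xs ] ∑[ y ∈ ys ] f x y ≡ ∑[ y ∈ ys ] ∑[ x ∈ xs ] f x y
∑-comm []       ys f = sym (∑-zero ys)
∑-comm (x ∷ xs) ys f = trans (cong (∑ ys (f x) +_) (∑-comm xs ys f)) (sym (∑-+ ys (f x) _))

·-[] : ∀ b c → b · [ c ] ≡ [ b ∧ c ]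
·-[] true  c = refl
·-[] false c = refl

·-1 : ∀ b → b · 1 ≡ [ b ]
·-1 true  = refl
·-1 false = refl

dec-true⁻¹ : (a? : Dec A) → does a? ≡ true → A
dec-true⁻¹ (yes a) _ = a

∧-true⁻¹ : ∀ x {y} → x ∧ y ≡ true → x ≡ true × y ≡ true
∧-true⁻¹ true h = refl , h

∧-intro : ∀ {x y} → x ≡ true → y ≡ true → x ∧ y ≡ true
∧-intro refl refl = refl

not-true : ∀ {x} → not x ≡ true → x ≢ true
not-true {false} _ ()

∨-true⁻¹ : ∀ x {y} → x ∨ y ≡ true → x ≡ true ⊎ y ≡ true
∨-true⁻¹ true  _ = inj₁ refl
∨-true⁻¹ false h = inj₂ h

∨-introˡ : ∀ {x y} → x ≡ true → x ∨ y ≡ true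
∨-introˡ refl = refl

∨-introʳ : ∀ x {y} → y ≡ true → x ∨ y ≡ true
∨-introʳ true  _ = refl
∨-introʳ false h = h

bool-ext : {x y : Bool} → (x ≡ true → y ≡ true) → (y ≡ true → x ≡ true) → x ≡ y
bool-ext to from = Bool.⇔→≡ (mk⇔ to from)

∀-Bool? : {P : Bool → Set ℓ} → (∀ b → Dec (P b)) → Dec (∀ b → P b)
∀-Bool? P? = map′ (λ (t , f) → λ { true → t ; false → f }) (λ h → h true , h false) (P? true ×-dec P? false)

-- Counting with enumerations

record Enumerates {A : Set ℓ} (_≟_ : DecidableEquality A) (xs : List A) : Set ℓ where
  field
    occurs-once : ∀ a → ∑[ x ∈ xs ] [ does (x ≟ a) ] ≡ 1
open Enumerates

count-unique : {_≟_ : DecidableEquality A} {xs : List A} → Enumerates _≟_ xs →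
               (S : A → Bool) {a : A} → S a ≡ true → (∀ x → S x ≡ true → x ≡ a) → ∑[ x ∈ xs ] [ S x ] ≡ 1
count-unique {_≟_ = _≟_} {xs} enum S {a} Sa unique = trans (∑-cong xs S≗≟a) (occurs-once enum a)
  where
  S≗≟a : ∀ x → [ S x ] ≡ [ does (x ≟ a) ]
  S≗≟a x with S x in Sx
  ... | true  = cong [_] (sym (dec-true (x ≟ a) (unique x Sx)))
  ... | false = cong [_] (sym (dec-false (x ≟ a) λ { refl → not-¬ Sa Sx }))

count-bijection : {_≟A_ : DecidableEquality A} {_≟B_ : DecidableEquality B} {xs : List A} {ys : List B} →
  Enumerates _≟A_ xs → Enumerates _≟B_ ys →
  (P : A → Bool) (Q : B → Bool) (f : B → A) →
  (∀ y → Q y ≡ true → P (f y) ≡ true) →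
  (∀ x → P x ≡ true → ∃[ y ] Q y ≡ true × f y ≡ x) →
  (∀ y y′ → Q y ≡ true → Q y′ ≡ true → f y ≡ f y′ → y ≡ y′) →
  ∑[ x ∈ xs ] [ P x ] ≡ ∑[ y ∈ ys ] [ Q y ]
count-bijection {_≟A_ = _≟A_} {xs = xs} {ys} enumA enumB P Q f Q⇒P P⇒Q f-injective = begin
  ∑[ x ∈ xs ] [ P x ]                                ≡⟨ ∑-cong xs fibre-size ⟩
  ∑[ x ∈ xs ] ∑[ y ∈ ys ] [ Q y ∧ does (f y ≟A x) ]  ≡⟨ ∑-comm xs ys _ ⟩
  ∑[ y ∈ ys ] ∑[ x ∈ xs ] [ Q y ∧ does (f y ≟A x) ]  ≡⟨ ∑-cong ys image-size ⟩
  ∑[ y ∈ ys ] [ Q y ]                                ∎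
  where
  open ≡-Reasoning

  fibre-size : ∀ x → [ P x ] ≡ ∑[ y ∈ ys ] [ Q y ∧ does (f y ≟A x) ]
  fibre-size x with P x in Px
  ... | true  with P⇒Q x Px
  ...   | y₀ , Qy₀ , fy₀≡x = sym (count-unique enumB _ Qy₀∧fy₀≡x unique)
    where
    Qy₀∧fy₀≡x : (Q y₀ ∧ does (f y₀ ≟A x)) ≡ true
    Qy₀∧fy₀≡x rewrite Qy₀ = dec-true (f y₀ ≟A x) fy₀≡x
    unique : ∀ y → (Q y ∧ does (f y ≟A x)) ≡ true → y ≡ y₀
    unique y h = f-injective y y₀ (proj₁ (∧-true⁻¹ _ h)) Qy₀
                   (trans (dec-true⁻¹ (f y ≟A x) (proj₂ (∧-true⁻¹ _ h))) (sym fy₀≡x))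
  fibre-size x | false = sym (trans (∑-cong ys none) (∑-zero ys))
    where
    none : ∀ y → [ Q y ∧ does (f y ≟A x) ] ≡ 0
    none y with Q y in Qy | f y ≟A x
    ... | true  | yes refl = ⊥-elim (not-¬ (Q⇒P y Qy) Px)
    ... | true  | no _     = refl
    ... | false | _        = refl

  image-size : ∀ y → ∑[ x ∈ xs ] [ Q y ∧ does (f y ≟A x) ] ≡ [ Q y ]
  image-size y = begin
    ∑[ x ∈ xs ] [ Q y ∧ does (f y ≟A x) ]    ≡⟨ ∑-cong xs (λ x → sym (·-[] (Q y) _)) ⟩
    ∑[ x ∈ xs ] Q y · [ does (f y ≟A x) ]    ≡⟨ ∑-· (Q y) xs _ ⟩
    Q y · (∑[ x ∈ xs ] [ does (f y ≟A x) ])  ≡⟨ cong (Q y ·_) (count-unique enumA _ (dec-true (f y ≟A f y) refl)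
                                                                 λ x e → sym (dec-true⁻¹ (f y ≟A x) e)) ⟩
    Q y · 1                                  ≡⟨ ·-1 (Q y) ⟩
    [ Q y ]                                  ∎

count-reindex : {_≟_ : DecidableEquality A} {xs : List A} → Enumerates _≟_ xs →
  (f g : A → A) → (∀ x → g (f x) ≡ x) → (∀ x → f (g x) ≡ x) → (P : A → Bool) →
  ∑[ x ∈ xs ] [ P (f x) ] ≡ ∑[ x ∈ xs ] [ P x ]
count-reindex enum f g g∘f f∘g P = count-bijection enum enum (P ∘ f) P g
  (λ y Py → subst (λ z → P z ≡ true) (sym (f∘g y)) Py)
  (λ x Pfx → f x , Pfx , g∘f x)
  (λ y y′ _ _ gy≡gy′ → trans (sym (f∘g y)) (trans (cong f gy≡gy′) (f∘g y′)))

infix 4 _≟ᶠ_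

-- Decided through toℕ, so that does (i ≟ᶠ j) reduces to i ==F j.
_≟ᶠ_ : DecidableEquality (Fin m)
i ≟ᶠ j = map′ toℕ-injective (cong toℕ) (toℕ i ℕ.≟ toℕ j)

allFin-enumerates : ∀ m → Enumerates _≟ᶠ_ (allFin m)
occurs-once (allFin-enumerates (suc m)) i = begin
  ∑[ j ∈ allFin (suc m) ] [ does (j ≟ᶠ i) ]
    ≡⟨ cong (λ js → ∑ (zero ∷ js) (λ j → [ does (j ≟ᶠ i) ])) (sym (map-tabulate {n = m} id suc)) ⟩
  [ does (zero ≟ᶠ i) ] + ∑ (map suc (allFin m)) (λ j → [ does (j ≟ᶠ i) ])
    ≡⟨ cong ([ does (zero ≟ᶠ i) ] +_) (∑-map suc (allFin m) _) ⟩
  [ does (zero ≟ᶠ i) ] + (∑[ j ∈ allFin m ] [ does (suc j ≟ᶠ i) ])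
    ≡⟨ shift i ⟩
  1 ∎
  where
  open ≡-Reasoning
  shift : ∀ i → [ does (zero ≟ᶠ i) ] + (∑[ j ∈ allFin m ] [ does (suc j ≟ᶠ i) ]) ≡ 1
  shift zero    = cong suc (∑-zero (allFin m))
  shift (suc i) = occurs-once (allFin-enumerates m) i

<F-irrefl : (x : Fin m) → (x <F x) ≡ false
<F-irrefl x = dec-false (x <? x) (<-irrefl refl)

<F-flip : {x y : Fin m} → x ≢ y → does (y <? x) ≡ not (does (x <? y))
<F-flip {x = x} {y} x≢y with <-cmp x y
... | tri< x<y _ _ = trans (dec-false (y <? x) (<-asym x<y)) (cong not (sym (dec-true (x <? y) x<y)))
... | tri≈ _ x≡y _ = ⊥-elim (x≢y x≡y)
... | tri> _ _ y<x = trans (dec-true (y <? x) y<x) (cong not (sym (dec-false (x <? y) (<-asym y<x))))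

<F⇒< : {x y : Fin m} → (x <F y) ≡ true → x < y
<F⇒< {x = x} {y} = dec-true⁻¹ (x <? y)

==F-refl : (x : Fin m) → (x ==F x) ≡ true
==F-refl x = dec-true (x ≟ᶠ x) refl

×-≟ : DecidableEquality A → DecidableEquality B → DecidableEquality (A × B)
×-≟ _≟₁_ _≟₂_ (a , b) (a′ , b′) = map′ (λ (p , q) → cong₂ _,_ p q) ,-injective (a ≟₁ a′ ×-dec b ≟₂ b′)

cartesianProduct-enumerates : {_≟₁_ : DecidableEquality A} {_≟₂_ : DecidableEquality B} {xs : List A} {ys : List B} →
  Enumerates _≟₁_ xs → Enumerates _≟₂_ ys → Enumerates (×-≟ _≟₁_ _≟₂_) (cartesianProduct xs ys)
occurs-once (cartesianProduct-enumerates {_≟₁_ = _≟₁_} {_≟₂_} {xs} {ys} enum₁ enum₂) (a , b) = begin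
  ∑ (cartesianProduct xs ys) (λ p → [ does (×-≟ _≟₁_ _≟₂_ p (a , b)) ]) ≡⟨ ∑-cartesianProduct xs ys _ ⟩
  ∑[ x ∈ xs ] ∑[ y ∈ ys ] [ does (x ≟₁ a) ∧ does (y ≟₂ b) ]            ≡⟨ ∑-cong xs split ⟩
  ∑[ x ∈ xs ] [ does (x ≟₁ a) ]                                        ≡⟨ occurs-once enum₁ a ⟩
  1                                                                    ∎
  where
  open ≡-Reasoning
  split : ∀ x → ∑[ y ∈ ys ] [ does (x ≟₁ a) ∧ does (y ≟₂ b) ] ≡ [ does (x ≟₁ a) ]
  split x = begin
    ∑[ y ∈ ys ] [ does (x ≟₁ a) ∧ does (y ≟₂ b) ]   ≡⟨ ∑-cong ys (λ y → sym (·-[] (does (x ≟₁ a)) _)) ⟩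
    ∑[ y ∈ ys ] does (x ≟₁ a) · [ does (y ≟₂ b) ]   ≡⟨ ∑-· (does (x ≟₁ a)) ys _ ⟩
    does (x ≟₁ a) · (∑[ y ∈ ys ] [ does (y ≟₂ b) ]) ≡⟨ cong (does (x ≟₁ a) ·_) (occurs-once enum₂ b) ⟩
    does (x ≟₁ a) · 1                               ≡⟨ ·-1 (does (x ≟₁ a)) ⟩
    [ does (x ≟₁ a) ]                               ∎

Tuple4 : Set ℓ → Set ℓ
Tuple4 A = A × A × A × A

tuples4 : List A → List (Tuple4 A)
tuples4 xs = cartesianProduct xs (cartesianProduct xs (cartesianProduct xs xs))

tuple4-≟ : DecidableEquality A → DecidableEquality (Tuple4 A)
tuple4-≟ _≟_ = ×-≟ _≟_ (×-≟ _≟_ (×-≟ _≟_ _≟_))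

tuples4-enumerates : {_≟_ : DecidableEquality A} {xs : List A} → Enumerates _≟_ xs → Enumerates (tuple4-≟ _≟_) (tuples4 xs)
tuples4-enumerates e = cartesianProduct-enumerates e (cartesianProduct-enumerates e (cartesianProduct-enumerates e e))

∑-tuples4 : (xs : List A) (f : Tuple4 A → ℕ) →
            ∑ (tuples4 xs) f ≡ ∑[ a ∈ xs ] ∑[ b ∈ xs ] ∑[ c ∈ xs ] ∑[ d ∈ xs ] f (a , b , c , d)
∑-tuples4 xs f =
  trans (∑-cartesianProduct xs _ f) (∑-cong xs λ a →
  trans (∑-cartesianProduct xs _ _) (∑-cong xs λ b →
  ∑-cartesianProduct xs xs _))

triples : {A : Set} → List A → List (Triple A)
triples xs = concatMap (λ a → concatMap (λ b → map (λ c → (a , b , c)) xs) xs) xs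

triple-≟ : {A : Set} → DecidableEquality A → DecidableEquality (Triple A)
triple-≟ _≟_ = ×-≟ _≟_ (×-≟ _≟_ _≟_)

triples-enumerates : {A : Set} {_≟_ : DecidableEquality A} {xs : List A} →
                     Enumerates _≟_ xs → Enumerates (triple-≟ _≟_) (triples xs)
occurs-once (triples-enumerates {_≟_ = _≟_} {xs} enum) t =
  trans (as-cartesianProduct (λ s → [ does (triple-≟ _≟_ s t) ]))
        (occurs-once (cartesianProduct-enumerates enum (cartesianProduct-enumerates enum enum)) t)
  where
  as-cartesianProduct : ∀ f → ∑ (triples xs) f ≡ ∑ (cartesianProduct xs (cartesianProduct xs xs)) f
  as-cartesianProduct f =
    trans (∑-concatMap _ xs f) (trans (∑-cong xs λ a → trans (∑-concatMap _ xs f) (∑-cong xs λ b → ∑-map _ xs f))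
          (sym (trans (∑-cartesianProduct xs _ f) (∑-cong xs λ a → ∑-cartesianProduct xs xs _))))

lookup-filterᵇ : (P : A → Bool) (xs : List A) (i : Fin (length (filterᵇ P xs))) → P (lookup (filterᵇ P xs) i) ≡ true
lookup-filterᵇ P (x ∷ xs) i with P x in Px
lookup-filterᵇ P (x ∷ xs) zero    | true  = Px
lookup-filterᵇ P (x ∷ xs) (suc i) | true  = lookup-filterᵇ P xs i
lookup-filterᵇ P (x ∷ xs) i       | false = lookup-filterᵇ P xs i

∃-lookup : (xs : List A) (S : A → Bool) → ∑[ x ∈ xs ] [ S x ] ≡ 1 → ∃[ i ] S (lookup xs i) ≡ true
∃-lookup (x ∷ xs) S once with S x in Sx
... | true  = zero , Sx
... | false = let i , Si = ∃-lookup xs S once in suc i , Si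

lookup⇒∑≢0 : (xs : List A) (S : A → Bool) {i : Fin (length xs)} → S (lookup xs i) ≡ true → ∑[ x ∈ xs ] [ S x ] ≢ 0
lookup⇒∑≢0 (x ∷ xs) S {zero}  Sx rewrite Sx = λ ()
lookup⇒∑≢0 (x ∷ xs) S {suc i} Si = lookup⇒∑≢0 xs S Si ∘ ℕ.m+n≡0⇒n≡0 [ S x ]

lookup-unique : (xs : List A) (S : A → Bool) → ∑[ x ∈ xs ] [ S x ] ≡ 1 →
                {i j : Fin (length xs)} → S (lookup xs i) ≡ true → S (lookup xs j) ≡ true → i ≡ j
lookup-unique (x ∷ xs) S once {zero}  {zero}  Si Sj = refl
lookup-unique (x ∷ xs) S once {zero}  {suc j} Si Sj rewrite Si = ⊥-elim (lookup⇒∑≢0 xs S Sj (ℕ.suc-injective once))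
lookup-unique (x ∷ xs) S once {suc i} {zero}  Si Sj rewrite Sj = ⊥-elim (lookup⇒∑≢0 xs S Si (ℕ.suc-injective once))
lookup-unique (x ∷ xs) S once {suc i} {suc j} Si Sj with S x
... | true  = ⊥-elim (lookup⇒∑≢0 xs S Si (ℕ.suc-injective once))
... | false = cong suc (lookup-unique xs S once Si Sj)

-- Permutations of four positions

swapAt : Fin 3 → Tuple4 A → Tuple4 A
swapAt zero             (a , b , c , d) = (b , a , c , d)
swapAt (suc zero)       (a , b , c , d) = (a , c , b , d)
swapAt (suc (suc zero)) (a , b , c , d) = (a , b , d , c)

swapAt-involutive : ∀ k (x : Tuple4 A) → swapAt k (swapAt k x) ≡ x
swapAt-involutive zero             x = refl
swapAt-involutive (suc zero)       x = refl
swapAt-involutive (suc (suc zero)) x = refl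

permute : List (Fin 3) → Tuple4 A → Tuple4 A
permute ks x = foldr swapAt x ks

unpermute : List (Fin 3) → Tuple4 A → Tuple4 A
unpermute ks x = foldl (flip swapAt) x ks

unpermute-permute : ∀ ks (x : Tuple4 A) → unpermute ks (permute ks x) ≡ x
unpermute-permute []       x = refl
unpermute-permute (k ∷ ks) x =
  trans (cong (unpermute ks) (swapAt-involutive k (permute ks x))) (unpermute-permute ks x)

permute-unpermute : ∀ ks (x : Tuple4 A) → permute ks (unpermute ks x) ≡ x
permute-unpermute []       x = refl
permute-unpermute (k ∷ ks) x =
  trans (cong (swapAt k) (permute-unpermute ks (swapAt k x))) (swapAt-involutive k x)

-- Each permutation of S₄ factors uniquely as u v w with u ∈ {e, s₀}, v ∈ {e, s₁, s₁s₀} and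
-- w ∈ {e, s₂, s₂s₁, s₂s₁s₀}; the proof only uses the two counts below, which are evaluated.
permutations : List (List (Fin 3))
permutations =
  cartesianProductWith _++_ ([] ∷ (# 0 ∷ []) ∷ [])
    (cartesianProductWith _++_ ([] ∷ (# 1 ∷ []) ∷ (# 1 ∷ # 0 ∷ []) ∷ [])
       ([] ∷ (# 2 ∷ []) ∷ (# 2 ∷ # 1 ∷ []) ∷ (# 2 ∷ # 1 ∷ # 0 ∷ []) ∷ []))

infix 25 _!_

_!_ : Tuple4 A → Fin 4 → A
(a , b , c , d) ! zero                   = a
(a , b , c , d) ! suc zero               = b
(a , b , c , d) ! suc (suc zero)         = c
(a , b , c , d) ! suc (suc (suc zero))   = d

Table : Set
Table = Fin 4 → Fin 4 → Bool

positions : Tuple4 (Fin 4)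
positions = (# 0 , # 1 , # 2 , # 3)

sortedBy : (A → A → Bool) → Tuple4 A → Bool
sortedBy _<_ (a , b , c , d) = a < b ∧ b < c ∧ c < d

-- a ≠ c and b ≠ d are not implied by the rest: for a = c the non-edge a ≁ c holds by irreflexivity.
directedC4ᵇ : (A → A → Bool) → (A → A → Bool) → Tuple4 A → Bool
directedC4ᵇ _~_ _==_ (a , b , c , d) =
  a ~ b ∧ b ~ c ∧ c ~ d ∧ d ~ a ∧ not (a ~ c) ∧ not (b ~ d) ∧ not (a == c) ∧ not (b == d)

sortings : Table → ℕ
sortings R = ∑[ w ∈ permutations ] [ sortedBy R (permute w positions) ]

cycleOrders : Table → Table → ℕ
cycleOrders R E = ∑[ w ∈ permutations ] [ directedC4ᵇ R E (unpermute w positions) ]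

TransitiveTable : Table → Set
TransitiveTable R = ∀ i j k → R i j ≡ true → R j k ≡ true → R i k ≡ true

module _ (q₀₁ q₀₂ q₀₃ q₁₂ q₁₃ q₂₃ : Bool) where

  orderTable : Table
  orderTable zero                   zero                   = false
  orderTable zero                   (suc zero)             = q₀₁
  orderTable zero                   (suc (suc zero))       = q₀₂
  orderTable zero                   (suc (suc (suc zero))) = q₀₃
  orderTable (suc zero)             zero                   = not q₀₁
  orderTable (suc zero)             (suc zero)             = false
  orderTable (suc zero)             (suc (suc zero))       = q₁₂
  orderTable (suc zero)             (suc (suc (suc zero))) = q₁₃
  orderTable (suc (suc zero))       zero                   = not q₀₂
  orderTable (suc (suc zero))       (suc zero)             = not q₁₂
  orderTable (suc (suc zero))       (suc (suc zero))       = false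
  orderTable (suc (suc zero))       (suc (suc (suc zero))) = q₂₃
  orderTable (suc (suc (suc zero))) zero                   = not q₀₃
  orderTable (suc (suc (suc zero))) (suc zero)             = not q₁₃
  orderTable (suc (suc (suc zero))) (suc (suc zero))       = not q₂₃
  orderTable (suc (suc (suc zero))) (suc (suc (suc zero))) = false

  adjacencyTable : Table
  adjacencyTable zero                   zero                   = false
  adjacencyTable zero                   (suc zero)             = q₀₁
  adjacencyTable zero                   (suc (suc zero))       = q₀₂
  adjacencyTable zero                   (suc (suc (suc zero))) = q₀₃
  adjacencyTable (suc zero)             zero                   = q₀₁
  adjacencyTable (suc zero)             (suc zero)             = false
  adjacencyTable (suc zero)             (suc (suc zero))       = q₁₂
  adjacencyTable (suc zero)             (suc (suc (suc zero))) = q₁₃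
  adjacencyTable (suc (suc zero))       zero                   = q₀₂
  adjacencyTable (suc (suc zero))       (suc zero)             = q₁₂
  adjacencyTable (suc (suc zero))       (suc (suc zero))       = false
  adjacencyTable (suc (suc zero))       (suc (suc (suc zero))) = q₂₃
  adjacencyTable (suc (suc (suc zero))) zero                   = q₀₃
  adjacencyTable (suc (suc (suc zero))) (suc zero)             = q₁₃
  adjacencyTable (suc (suc (suc zero))) (suc (suc zero))       = q₂₃
  adjacencyTable (suc (suc (suc zero))) (suc (suc (suc zero))) = false

transitive? : ∀ R → Dec (TransitiveTable R)
transitive? R = all? λ i → all? λ j → all? λ k →
  (R i j Bool.≟ true) →-dec ((R j k Bool.≟ true) →-dec (R i k Bool.≟ true))

orderTable-sortings : ∀ q₀₁ q₀₂ q₀₃ q₁₂ q₁₃ q₂₃ → let R = orderTable q₀₁ q₀₂ q₀₃ q₁₂ q₁₃ q₂₃ in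
                      TransitiveTable R → sortings R ≡ 1
orderTable-sortings = from-yes
  (∀-Bool? λ q₀₁ → ∀-Bool? λ q₀₂ → ∀-Bool? λ q₀₃ → ∀-Bool? λ q₁₂ → ∀-Bool? λ q₁₃ → ∀-Bool? λ q₂₃ →
   let R = orderTable q₀₁ q₀₂ q₀₃ q₁₂ q₁₃ q₂₃ in transitive? R →-dec (sortings R ℕ.≟ 1))

adjacencyTable-cycleOrders : ∀ q₀₁ q₀₂ q₀₃ q₁₂ q₁₃ q₂₃ → let R = adjacencyTable q₀₁ q₀₂ q₀₃ q₁₂ q₁₃ q₂₃ in
                             cycleOrders R _==F_ ≡ 8 * [ isInducedC4 R id ]
adjacencyTable-cycleOrders = from-yes
  (∀-Bool? λ q₀₁ → ∀-Bool? λ q₀₂ → ∀-Bool? λ q₀₃ → ∀-Bool? λ q₁₂ → ∀-Bool? λ q₁₃ → ∀-Bool? λ q₂₃ →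
   let R = adjacencyTable q₀₁ q₀₂ q₀₃ q₁₂ q₁₃ q₂₃ in cycleOrders R _==F_ ℕ.≟ 8 * [ isInducedC4 R id ])

tabulated : Table → Table
tabulated R i j = Vec.lookup (Vec.lookup (Vec.tabulate (Vec.tabulate ∘ R)) i) j

-- tabulated R agrees with R only pointwise, but a Φ that evaluates its table at closed
-- indices only cannot tell them apart (Φ-closed is then refl), and tabulated is
-- invariant under pointwise equality: this is function extensionality for such Φ.
table-cong : (Φ : Table → B) → (∀ R → Φ R ≡ Φ (tabulated R)) → ∀ {R R′} → (∀ i j → R i j ≡ R′ i j) → Φ R ≡ Φ R′
table-cong Φ Φ-closed {R} {R′} R≗R′ =
  trans (Φ-closed R)
        (trans (cong (λ v → Φ (λ i j → Vec.lookup (Vec.lookup v i) j)) (Vec.tabulate-cong λ i → Vec.tabulate-cong (R≗R′ i)))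
               (sym (Φ-closed R′)))

record AllDistinct {A : Set ℓ} (a b c d : A) : Set ℓ where
  field
    a≢b : a ≢ b
    a≢c : a ≢ c
    a≢d : a ≢ d
    b≢c : b ≢ c
    b≢d : b ≢ d
    c≢d : c ≢ d

module _ {a b c d : Fin m} (distinct : AllDistinct a b c d) where
  open AllDistinct distinct
  private
    x = (a , b , c , d)

  orderTable-distinct : ∀ i j → (x ! i <F x ! j) ≡ orderTable (a <F b) (a <F c) (a <F d) (b <F c) (b <F d) (c <F d) i j
  orderTable-distinct zero                   zero                   = <F-irrefl a
  orderTable-distinct zero                   (suc zero)             = refl
  orderTable-distinct zero                   (suc (suc zero))       = refl
  orderTable-distinct zero                   (suc (suc (suc zero))) = refl
  orderTable-distinct (suc zero)             zero                   = <F-flip a≢b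
  orderTable-distinct (suc zero)             (suc zero)             = <F-irrefl b
  orderTable-distinct (suc zero)             (suc (suc zero))       = refl
  orderTable-distinct (suc zero)             (suc (suc (suc zero))) = refl
  orderTable-distinct (suc (suc zero))       zero                   = <F-flip a≢c
  orderTable-distinct (suc (suc zero))       (suc zero)             = <F-flip b≢c
  orderTable-distinct (suc (suc zero))       (suc (suc zero))       = <F-irrefl c
  orderTable-distinct (suc (suc zero))       (suc (suc (suc zero))) = refl
  orderTable-distinct (suc (suc (suc zero))) zero                   = <F-flip a≢d
  orderTable-distinct (suc (suc (suc zero))) (suc zero)             = <F-flip b≢d
  orderTable-distinct (suc (suc (suc zero))) (suc (suc zero))       = <F-flip c≢d
  orderTable-distinct (suc (suc (suc zero))) (suc (suc (suc zero))) = <F-irrefl d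

  ==F-distinct : ∀ i j → (x ! i ==F x ! j) ≡ (i ==F j)
  ==F-distinct zero                   zero                   = dec-true (a ≟ᶠ a) refl
  ==F-distinct zero                   (suc zero)             = dec-false (a ≟ᶠ b) a≢b
  ==F-distinct zero                   (suc (suc zero))       = dec-false (a ≟ᶠ c) a≢c
  ==F-distinct zero                   (suc (suc (suc zero))) = dec-false (a ≟ᶠ d) a≢d
  ==F-distinct (suc zero)             zero                   = dec-false (b ≟ᶠ a) (a≢b ∘ sym)
  ==F-distinct (suc zero)             (suc zero)             = dec-true (b ≟ᶠ b) refl
  ==F-distinct (suc zero)             (suc (suc zero))       = dec-false (b ≟ᶠ c) b≢c
  ==F-distinct (suc zero)             (suc (suc (suc zero))) = dec-false (b ≟ᶠ d) b≢d
  ==F-distinct (suc (suc zero))       zero                   = dec-false (c ≟ᶠ a) (a≢c ∘ sym)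
  ==F-distinct (suc (suc zero))       (suc zero)             = dec-false (c ≟ᶠ b) (b≢c ∘ sym)
  ==F-distinct (suc (suc zero))       (suc (suc zero))       = dec-true (c ≟ᶠ c) refl
  ==F-distinct (suc (suc zero))       (suc (suc (suc zero))) = dec-false (c ≟ᶠ d) c≢d
  ==F-distinct (suc (suc (suc zero))) zero                   = dec-false (d ≟ᶠ a) (a≢d ∘ sym)
  ==F-distinct (suc (suc (suc zero))) (suc zero)             = dec-false (d ≟ᶠ b) (b≢d ∘ sym)
  ==F-distinct (suc (suc (suc zero))) (suc (suc zero))       = dec-false (d ≟ᶠ c) (c≢d ∘ sym)
  ==F-distinct (suc (suc (suc zero))) (suc (suc (suc zero))) = dec-true (d ≟ᶠ d) refl

  sortings-distinct : ∑[ w ∈ permutations ] [ sortedBy _<F_ (permute w x) ] ≡ 1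
  sortings-distinct = trans (table-cong sortings (λ _ → refl) orderTable-distinct)
                            (orderTable-sortings _ _ _ _ _ _ transitive)
    where
    less : ∀ i j → orderTable _ _ _ _ _ _ i j ≡ true → x ! i < x ! j
    less i j h = dec-true⁻¹ (x ! i <? x ! j) (trans (orderTable-distinct i j) h)
    transitive : TransitiveTable (orderTable (a <F b) (a <F c) (a <F d) (b <F c) (b <F d) (c <F d))
    transitive i j k ij jk =
      trans (sym (orderTable-distinct i k)) (dec-true (x ! i <? x ! k) (<-trans (less i j ij) (less j k jk)))

sorted⇒distinct : {a b c d : Fin m} → sortedBy _<F_ (a , b , c , d) ≡ true → AllDistinct a b c d
sorted⇒distinct {a = a} {b} {c} {d} s =
  let a<b , s′  = ∧-true⁻¹ (a <F b) s
      b<c , c<d = ∧-true⁻¹ (b <F c) s′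
  in distinct (<F⇒< a<b) (<F⇒< b<c) (<F⇒< c<d)
  where
  distinct : a < b → b < c → c < d → AllDistinct a b c d
  distinct a<b b<c c<d = record
    { a≢b = <⇒≢ a<b ; a≢c = <⇒≢ (<-trans a<b b<c) ; a≢d = <⇒≢ (<-trans (<-trans a<b b<c) c<d)
    ; b≢c = <⇒≢ b<c ; b≢d = <⇒≢ (<-trans b<c c<d) ; c≢d = <⇒≢ c<d }

-- Directed induced 4-cycles

record DirectedC4 {A : Set ℓ} (_~_ : A → A → Set ℓ′) (a b c d : A) : Set (ℓ ⊔ ℓ′) where
  field
    a~b : a ~ b
    b~c : b ~ c
    c~d : c ~ d
    d~a : d ~ a
    a≁c : ¬ a ~ c
    b≁d : ¬ b ~ d
    a≢c : a ≢ c
    b≢d : b ≢ d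

rotate : {_~_ : A → A → Set ℓ′} → Symmetric _~_ → ∀ {a b c d} → DirectedC4 _~_ a b c d → DirectedC4 _~_ b c d a
rotate ~-sym C = record
  { a~b = b~c ; b~c = c~d ; c~d = d~a ; d~a = a~b
  ; a≁c = b≁d ; b≁d = a≁c ∘ ~-sym ; a≢c = b≢d ; b≢d = a≢c ∘ sym }
  where open DirectedC4 C

directedC4 : (H : Graph) → Tuple4 (Fin (n H)) → Bool
directedC4 H = directedC4ᵇ (adj H) _==F_

module _ (H : Graph) {a b c d : Fin (n H)} where

  directedC4-sound : directedC4 H (a , b , c , d) ≡ true → DirectedC4 (Adj H) a b c d
  directedC4-sound h =
    let ab  , h₁ = ∧-true⁻¹ _ h
        bc  , h₂ = ∧-true⁻¹ _ h₁
        cd  , h₃ = ∧-true⁻¹ _ h₂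
        da  , h₄ = ∧-true⁻¹ _ h₃
        ac  , h₅ = ∧-true⁻¹ _ h₄
        bd  , h₆ = ∧-true⁻¹ _ h₅
        a=c , b=d = ∧-true⁻¹ _ h₆
    in record
      { a~b = ab ; b~c = bc ; c~d = cd ; d~a = da ; a≁c = not-true ac ; b≁d = not-true bd
      ; a≢c = not-true a=c ∘ dec-true (a ≟ᶠ c) ; b≢d = not-true b=d ∘ dec-true (b ≟ᶠ d) }

  directedC4-complete : DirectedC4 (Adj H) a b c d → directedC4 H (a , b , c , d) ≡ true
  directedC4-complete C =
    ∧-intro a~b (∧-intro b~c (∧-intro c~d (∧-intro d~a
      (∧-intro (cong not (Bool.¬-not a≁c)) (∧-intro (cong not (Bool.¬-not b≁d))
      (∧-intro (cong not (dec-false (a ≟ᶠ c) a≢c)) (cong not (dec-false (b ≟ᶠ d) b≢d))))))))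
    where open DirectedC4 C

adj⇒≢ : (H : Graph) {u v : Fin (n H)} → Adj H u v → u ≢ v
adj⇒≢ H {u} u~v refl = not-¬ u~v (irrefl H u)

directedC4⇒distinct : (H : Graph) {a b c d : Fin (n H)} → DirectedC4 (Adj H) a b c d → AllDistinct a b c d
directedC4⇒distinct H C = record
  { a≢b = adj⇒≢ H a~b ; a≢c = a≢c ; a≢d = adj⇒≢ H d~a ∘ sym
  ; b≢c = adj⇒≢ H b~c ; b≢d = b≢d ; c≢d = adj⇒≢ H c~d }
  where open DirectedC4 C

module _ (H : Graph) {a b c d : Fin (n H)} where
  private
    x = (a , b , c , d)

  adjacencyTable-graph : ∀ i j → adj H (x ! i) (x ! j)
                                 ≡ adjacencyTable (adj H a b) (adj H a c) (adj H a d) (adj H b c) (adj H b d) (adj H c d) i j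
  adjacencyTable-graph zero                   zero                   = irrefl H a
  adjacencyTable-graph zero                   (suc zero)             = refl
  adjacencyTable-graph zero                   (suc (suc zero))       = refl
  adjacencyTable-graph zero                   (suc (suc (suc zero))) = refl
  adjacencyTable-graph (suc zero)             zero                   = Defs.sym H b a
  adjacencyTable-graph (suc zero)             (suc zero)             = irrefl H b
  adjacencyTable-graph (suc zero)             (suc (suc zero))       = refl
  adjacencyTable-graph (suc zero)             (suc (suc (suc zero))) = refl
  adjacencyTable-graph (suc (suc zero))       zero                   = Defs.sym H c a
  adjacencyTable-graph (suc (suc zero))       (suc zero)             = Defs.sym H c b
  adjacencyTable-graph (suc (suc zero))       (suc (suc zero))       = irrefl H c
  adjacencyTable-graph (suc (suc zero))       (suc (suc (suc zero))) = refl
  adjacencyTable-graph (suc (suc (suc zero))) zero                   = Defs.sym H d a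
  adjacencyTable-graph (suc (suc (suc zero))) (suc zero)             = Defs.sym H d b
  adjacencyTable-graph (suc (suc (suc zero))) (suc (suc zero))       = Defs.sym H d c
  adjacencyTable-graph (suc (suc (suc zero))) (suc (suc (suc zero))) = irrefl H d

  -- The first step unfolds the 24 closed words: unpermute w x is then (x !_) applied
  -- componentwise to unpermute w positions.
  cycleOrders-sorted : sortedBy _<F_ x ≡ true →
    ∑[ w ∈ permutations ] [ directedC4 H (unpermute w x) ] ≡ 8 * [ isInducedC4 (adj H) (x !_) ]
  cycleOrders-sorted sorted = begin
    ∑[ w ∈ permutations ] [ directedC4 H (unpermute w x) ]
      ≡⟨⟩
    cycleOrders adjacency (λ i j → x ! i ==F x ! j)
      ≡⟨ table-cong (cycleOrders adjacency) (λ _ → refl) (==F-distinct (sorted⇒distinct {a = a} {b} {c} {d} sorted)) ⟩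
    cycleOrders adjacency _==F_
      ≡⟨ table-cong (λ R → cycleOrders R _==F_) (λ _ → refl) adjacencyTable-graph ⟩
    cycleOrders (adjacencyTable ab ac ad bc bd cd) _==F_
      ≡⟨ adjacencyTable-cycleOrders ab ac ad bc bd cd ⟩
    8 * [ isInducedC4 (adjacencyTable ab ac ad bc bd cd) id ]
      ≡⟨ cong (λ b → 8 * [ b ]) (table-cong (λ R → isInducedC4 R id) (λ _ → refl) (λ i j → sym (adjacencyTable-graph i j))) ⟩
    8 * [ isInducedC4 adjacency id ] ∎
    where
    open ≡-Reasoning
    adjacency : Table
    adjacency i j = adj H (x ! i) (x ! j)
    ab = adj H a b
    ac = adj H a c
    ad = adj H a d
    bc = adj H b c
    bd = adj H b d
    cd = adj H c d

numInducedC4-sorted : (m : ℕ) (adj : Fin m → Fin m → Bool) →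
  numInducedC4 m adj ≡ ∑[ x ∈ tuples4 (allFin m) ] [ sortedBy _<F_ x ∧ isInducedC4 adj (x !_) ]
numInducedC4-sorted m adj = begin
  numInducedC4 m adj
    ≡⟨ length-filterᵇ _ (quads m) ⟩
  ∑[ w ∈ quads m ] [ isInducedC4 adj w ]
    ≡⟨ trans (∑-concatMap _ xs _) (∑-cong xs λ a → trans (∑-concatMap _ (above a) _) (∑-cong (above a) λ b →
       trans (∑-concatMap _ (above b) _) (∑-cong (above b) λ c → ∑-map _ (above c) _))) ⟩
  ∑[ a ∈ xs ] ∑[ b ∈ above a ] ∑[ c ∈ above b ] ∑[ d ∈ above c ] induced (a , b , c , d)
    ≡⟨ ∑-cong xs (λ a → unfilter a) ⟩
  ∑[ a ∈ xs ] ∑[ b ∈ xs ] ∑[ c ∈ xs ] ∑[ d ∈ xs ] (a <F b) · (b <F c) · (c <F d) · induced (a , b , c , d)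
    ≡⟨ ∑-cong xs (λ a → ∑-cong xs λ b → ∑-cong xs λ c → ∑-cong xs λ d → ·-sorted (a <F b) (b <F c) (c <F d) _) ⟩
  ∑[ a ∈ xs ] ∑[ b ∈ xs ] ∑[ c ∈ xs ] ∑[ d ∈ xs ] [ sortedBy _<F_ (a , b , c , d) ∧ isInducedC4 adj ((a , b , c , d) !_) ]
    ≡⟨ sym (∑-tuples4 xs _) ⟩
  ∑[ x ∈ tuples4 xs ] [ sortedBy _<F_ x ∧ isInducedC4 adj (x !_) ] ∎
  where
  open ≡-Reasoning
  xs = allFin m
  above : Fin m → List (Fin m)
  above a = filterᵇ (a <F_) xs
  induced : Tuple4 (Fin m) → ℕ
  induced x = [ isInducedC4 adj (x !_) ]

  ·-sorted : ∀ p q r s → p · q · r · [ s ] ≡ [ (p ∧ q ∧ r) ∧ s ]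
  ·-sorted true  true  true  s = refl
  ·-sorted true  true  false s = refl
  ·-sorted true  false r     s = refl
  ·-sorted false q     r     s = refl

  unfilter : ∀ a → ∑[ b ∈ above a ] ∑[ c ∈ above b ] ∑[ d ∈ above c ] induced (a , b , c , d)
                 ≡ ∑[ b ∈ xs ] ∑[ c ∈ xs ] ∑[ d ∈ xs ] (a <F b) · (b <F c) · (c <F d) · induced (a , b , c , d)
  unfilter a = trans (∑-filterᵇ _ xs _) (∑-cong xs λ b →
    trans (cong ((a <F b) ·_) (trans (∑-filterᵇ _ xs _) (∑-cong xs λ c →
      trans (cong ((b <F c) ·_) (∑-filterᵇ _ xs _)) (sym (∑-· (b <F c) xs _)))))
    (trans (sym (∑-· (a <F b) xs _)) (∑-cong xs λ c → sym (∑-· (a <F b) xs _))))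

numDirectedC4 : Graph → ℕ
numDirectedC4 H = ∑[ x ∈ tuples4 (allFin (n H)) ] [ directedC4 H x ]

numDirectedC4≡8*numInducedC4 : (H : Graph) → numDirectedC4 H ≡ 8 * numInducedC4 (n H) (adj H)
numDirectedC4≡8*numInducedC4 H = begin
  ∑[ x ∈ xs ] [ directed x ]
    ≡⟨ ∑-cong xs one-sorting ⟩
  ∑[ x ∈ xs ] ∑[ w ∈ permutations ] [ directed x ∧ sorted (permute w x) ]
    ≡⟨ ∑-comm xs permutations (λ x w → [ directed x ∧ sorted (permute w x) ]) ⟩
  ∑[ w ∈ permutations ] ∑[ x ∈ xs ] [ directed x ∧ sorted (permute w x) ]
    ≡⟨ ∑-cong permutations reindex ⟩
  ∑[ w ∈ permutations ] ∑[ y ∈ xs ] [ sorted y ∧ directed (unpermute w y) ]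
    ≡⟨ ∑-comm permutations xs (λ w y → [ sorted y ∧ directed (unpermute w y) ]) ⟩
  ∑[ y ∈ xs ] ∑[ w ∈ permutations ] [ sorted y ∧ directed (unpermute w y) ]
    ≡⟨ ∑-cong xs orbit ⟩
  ∑[ y ∈ xs ] 8 * [ sorted y ∧ isInducedC4 (adj H) (y !_) ]
    ≡⟨ ∑-*ˡ 8 xs _ ⟩
  8 * (∑[ y ∈ xs ] [ sorted y ∧ isInducedC4 (adj H) (y !_) ])
    ≡⟨ cong (8 *_) (sym (numInducedC4-sorted (n H) (adj H))) ⟩
  8 * numInducedC4 (n H) (adj H) ∎
  where
  open ≡-Reasoning
  xs = tuples4 (allFin (n H))
  directed = directedC4 H
  sorted = sortedBy _<F_

  one-sorting : ∀ x → [ directed x ] ≡ ∑[ w ∈ permutations ] [ directed x ∧ sorted (permute w x) ]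
  one-sorting x with directed x in dx
  ... | true  = sym (sortings-distinct (directedC4⇒distinct H (directedC4-sound H dx)))
  ... | false = sym (∑-zero permutations)

  reindex : ∀ w → ∑[ x ∈ xs ] [ directed x ∧ sorted (permute w x) ] ≡ ∑[ y ∈ xs ] [ sorted y ∧ directed (unpermute w y) ]
  reindex w = trans (∑-cong xs λ x → cong [_] (reorder x))
                    (count-reindex (tuples4-enumerates (allFin-enumerates (n H))) (permute w) (unpermute w)
                                   (unpermute-permute w) (permute-unpermute w) (λ y → sorted y ∧ directed (unpermute w y)))
    where
    reorder : ∀ x → (directed x ∧ sorted (permute w x)) ≡ (sorted (permute w x) ∧ directed (unpermute w (permute w x)))
    reorder x = trans (Bool.∧-comm (directed x) _) (cong (λ z → sorted (permute w x) ∧ directed z) (sym (unpermute-permute w x)))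

  orbit : ∀ y → ∑[ w ∈ permutations ] [ sorted y ∧ directed (unpermute w y) ] ≡ 8 * [ sorted y ∧ isInducedC4 (adj H) (y !_) ]
  orbit y with sorted y in sy
  ... | true  = cycleOrders-sorted H sy
  ... | false = ∑-zero permutations

-- Triangles

infix 4 _∈△_

data _∈△_ {A : Set} (x : A) : Triple A → Set where
  first  : ∀ {q r} → x ∈△ (x , q , r)
  second : ∀ {p r} → x ∈△ (p , x , r)
  third  : ∀ {p q} → x ∈△ (p , q , x)

_∈ᵇ_ : Fin m → Triple (Fin m) → Bool
x ∈ᵇ (p , q , r) = any (x ==F_) (p ∷ q ∷ r ∷ [])

commonVertex : Triple (Fin m) → Triple (Fin m) → Fin m
commonVertex (p , q , r) t = if p ∈ᵇ t then p else if q ∈ᵇ t then q else r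

∈ᵇ-sound : {x : Fin m} (t : Triple (Fin m)) → x ∈ᵇ t ≡ true → x ∈△ t
∈ᵇ-sound {x = x} (p , q , r) h with ∨-true⁻¹ (x ==F p) h
... | inj₁ x=p with refl ← dec-true⁻¹ (x ≟ᶠ p) x=p = first
... | inj₂ h with ∨-true⁻¹ (x ==F q) h
... | inj₁ x=q with refl ← dec-true⁻¹ (x ≟ᶠ q) x=q = second
... | inj₂ h with ∨-true⁻¹ (x ==F r) h
... | inj₁ x=r with refl ← dec-true⁻¹ (x ≟ᶠ r) x=r = third

∈ᵇ-complete : {x : Fin m} {t : Triple (Fin m)} → x ∈△ t → x ∈ᵇ t ≡ true
∈ᵇ-complete {x = x} first              = ∨-introˡ (==F-refl x)
∈ᵇ-complete {x = x} (second {p = p})   = ∨-introʳ (x ==F p) (∨-introˡ (==F-refl x))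
∈ᵇ-complete {x = x} (third {p = p} {q}) = ∨-introʳ (x ==F p) (∨-introʳ (x ==F q) (∨-introˡ (==F-refl x)))

shareVertex-complete : {x : Fin m} (t t′ : Triple (Fin m)) → x ∈△ t → x ∈△ t′ → shareVertex t t′ ≡ true
shareVertex-complete (p , q , r) t′ first   x∈t′ = ∨-introˡ (∈ᵇ-complete x∈t′)
shareVertex-complete (p , q , r) t′ second  x∈t′ = ∨-introʳ (p ∈ᵇ t′) (∨-introˡ (∈ᵇ-complete x∈t′))
shareVertex-complete (p , q , r) t′ third   x∈t′ = ∨-introʳ (p ∈ᵇ t′) (∨-introʳ (q ∈ᵇ t′) (∨-introˡ (∈ᵇ-complete x∈t′)))

commonVertex-shared : (t t′ : Triple (Fin m)) → shareVertex t t′ ≡ true → commonVertex t t′ ∈△ t × commonVertex t t′ ∈△ t′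
commonVertex-shared (p , q , r) t′ h with p ∈ᵇ t′ in p∈t′
... | true  = first , ∈ᵇ-sound t′ p∈t′
... | false with q ∈ᵇ t′ in q∈t′
... | true  = second , ∈ᵇ-sound t′ q∈t′
... | false with r ∈ᵇ t′ in r∈t′
... | true  = third , ∈ᵇ-sound t′ r∈t′

∈△-bounds : {p q r x : Fin m} → p < q → q < r → x ∈△ (p , q , r) → p ≤ x × x ≤ r
∈△-bounds p<q q<r first  = ≤-refl , ℕ.<⇒≤ (<-trans p<q q<r)
∈△-bounds p<q q<r second = ℕ.<⇒≤ p<q , ℕ.<⇒≤ q<r
∈△-bounds p<q q<r third  = ℕ.<⇒≤ (<-trans p<q q<r) , ≤-refl

increasing-triple-ext : {p q r p′ q′ r′ : Fin m} → p < q → q < r → p′ < q′ → q′ < r′ →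
  (∀ {x} → x ∈△ (p , q , r) → x ∈△ (p′ , q′ , r′)) → (∀ {x} → x ∈△ (p′ , q′ , r′) → x ∈△ (p , q , r)) →
  (p , q , r) ≡ (p′ , q′ , r′)
increasing-triple-ext p<q q<r p′<q′ q′<r′ ⊆ ⊇
  with ≤-antisym (proj₁ (∈△-bounds p<q q<r (⊇ first))) (proj₁ (∈△-bounds p′<q′ q′<r′ (⊆ first)))
     | ≤-antisym (proj₂ (∈△-bounds p′<q′ q′<r′ (⊆ third))) (proj₂ (∈△-bounds p<q q<r (⊇ third)))
... | refl | refl with ⊆ second
... | first  = ⊥-elim (<-irrefl refl p<q)
... | second = refl
... | third  = ⊥-elim (<-irrefl refl q<r)

module Triangles (G : Graph) where

  V : Set
  V = Fin (n G)

  L : ℕ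
  L = length (triangles G)

  triangle : Fin L → Triple V
  triangle = lookup (triangles G)

  IsTriangle : Triple V → Set
  IsTriangle (p , q , r) = p < q × q < r × Adj G p q × Adj G q r × Adj G p r

  isTriangleᵇ : Triple V → Bool
  isTriangleᵇ (a , b , c) = (a <F b) ∧ (b <F c) ∧ adj G a b ∧ adj G b c ∧ adj G a c

  isTriangleᵇ-sound : ∀ t → isTriangleᵇ t ≡ true → IsTriangle t
  isTriangleᵇ-sound (a , b , c) h =
    let ab , h₁ = ∧-true⁻¹ _ h
        bc , h₂ = ∧-true⁻¹ _ h₁
        a~b , h₃ = ∧-true⁻¹ _ h₂
        b~c , a~c = ∧-true⁻¹ _ h₃
    in <F⇒< ab , <F⇒< bc , a~b , b~c , a~c

  isTriangleᵇ-complete : ∀ t → IsTriangle t → isTriangleᵇ t ≡ true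
  isTriangleᵇ-complete (a , b , c) (a<b , b<c , a~b , b~c , a~c) =
    ∧-intro (dec-true (a <? b) a<b) (∧-intro (dec-true (b <? c) b<c) (∧-intro a~b (∧-intro b~c a~c)))

  triangle-isTriangle : ∀ i → IsTriangle (triangle i)
  triangle-isTriangle i = isTriangleᵇ-sound (triangle i) (lookup-filterᵇ _ (triples (allFin (n G))) i)

  private
    _≟△_ : DecidableEquality (Triple V)
    _≟△_ = triple-≟ _≟ᶠ_

    occurs-once-in-triangles : ∀ t → IsTriangle t → ∑[ s ∈ triangles G ] [ does (s ≟△ t) ] ≡ 1
    occurs-once-in-triangles t t-tri = begin
      ∑[ s ∈ triangles G ] [ does (s ≟△ t) ]
        ≡⟨ ∑-filterᵇ isTriangleᵇ (triples (allFin (n G))) _ ⟩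
      ∑[ s ∈ triples (allFin (n G)) ] isTriangleᵇ s · [ does (s ≟△ t) ]
        ≡⟨ ∑-cong (triples (allFin (n G))) (λ s → ·-[] (isTriangleᵇ s) _) ⟩
      ∑[ s ∈ triples (allFin (n G)) ] [ isTriangleᵇ s ∧ does (s ≟△ t) ]
        ≡⟨ count-unique (triples-enumerates (allFin-enumerates (n G))) _
             (∧-intro (isTriangleᵇ-complete t t-tri) (dec-true (t ≟△ t) refl))
             (λ s h → dec-true⁻¹ (s ≟△ t) (proj₂ (∧-true⁻¹ (isTriangleᵇ s) h))) ⟩
      1 ∎
      where open ≡-Reasoning

  triangle-index : ∀ t → IsTriangle t → ∃[ i ] triangle i ≡ t
  triangle-index t t-tri =
    let i , h = ∃-lookup (triangles G) (λ s → does (s ≟△ t)) (occurs-once-in-triangles t t-tri)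
    in i , dec-true⁻¹ (triangle i ≟△ t) h

  triangle-injective : ∀ {i j} → triangle i ≡ triangle j → i ≡ j
  triangle-injective {i} {j} eq =
    lookup-unique (triangles G) (λ s → does (s ≟△ triangle j)) (occurs-once-in-triangles _ (triangle-isTriangle j))
                  (dec-true (triangle i ≟△ triangle j) eq) (dec-true (triangle j ≟△ triangle j) refl)

  ∈△-adjacent : ∀ {t x y} → IsTriangle t → x ∈△ t → y ∈△ t → x ≢ y → Adj G x y
  ∈△-adjacent _                          first  first  x≢x = ⊥-elim (x≢x refl)
  ∈△-adjacent (_ , _ , p~q , _ , _)      first  second _   = p~q
  ∈△-adjacent (_ , _ , _ , _ , p~r)      first  third  _   = p~r
  ∈△-adjacent (_ , _ , p~q , _ , _)      second first  _   = trans (Defs.sym G _ _) p~q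
  ∈△-adjacent _                          second second x≢x = ⊥-elim (x≢x refl)
  ∈△-adjacent (_ , _ , _ , q~r , _)      second third  _   = q~r
  ∈△-adjacent (_ , _ , _ , _ , p~r)      third  first  _   = trans (Defs.sym G _ _) p~r
  ∈△-adjacent (_ , _ , _ , q~r , _)      third  second _   = trans (Defs.sym G _ _) q~r
  ∈△-adjacent _                          third  third  x≢x = ⊥-elim (x≢x refl)

  infix 20 _∩_

  _∩_ : Fin L → Fin L → V
  T ∩ U = commonVertex (triangle T) (triangle U)

  triangleAdj-intro : ∀ {T U x} → T ≢ U → x ∈△ triangle T → x ∈△ triangle U → triangleAdj G T U ≡ true
  triangleAdj-intro {T} {U} T≢U x∈T x∈U =
    ∧-intro (cong not (dec-false (T ≟ᶠ U) T≢U)) (shareVertex-complete (triangle T) (triangle U) x∈T x∈U)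

  triangleAdj-elim : ∀ {T U} → triangleAdj G T U ≡ true → T ≢ U × T ∩ U ∈△ triangle T × T ∩ U ∈△ triangle U
  triangleAdj-elim {T} {U} h =
    let T≠U , shared = ∧-true⁻¹ _ h
    in not-true T≠U ∘ dec-true (T ≟ᶠ U) , commonVertex-shared (triangle T) (triangle U) shared

  triangleAdj-sym : ∀ T U → triangleAdj G T U ≡ true → triangleAdj G U T ≡ true
  triangleAdj-sym T U h = let T≢U , ∩∈T , ∩∈U = triangleAdj-elim h in triangleAdj-intro (T≢U ∘ sym) ∩∈U ∩∈T

triangleGraph : Graph → Graph
triangleGraph G = record
  { n      = length (triangles G)
  ; adj    = triangleAdj G
  ; sym    = λ T U → bool-ext (triangleAdj-sym T U) (triangleAdj-sym U T)
  ; irrefl = λ T → cong (λ b → not b ∧ shareVertex (triangle T) (triangle T)) (==F-refl T)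
  }
  where open Triangles G

module LocallyLinearTriangles (G : Graph) (ll : LocallyLinear G) where
  open Triangles G

  infix 4 _~_ _~*_

  private
    _~_ : V → V → Set
    _~_ = Adj G

    _~*_ : Fin L → Fin L → Set
    _~*_ = Adj (triangleGraph G)

  ~-sym : Symmetric _~_
  ~-sym {u} {v} u~v = trans (Defs.sym G v u) u~v

  ~-rotate : ∀ {a b c d} → DirectedC4 _~_ a b c d → DirectedC4 _~_ b c d a
  ~-rotate = rotate ~-sym

  ~*-rotate : ∀ {T₁ T₂ T₃ T₄} → DirectedC4 _~*_ T₁ T₂ T₃ T₄ → DirectedC4 _~*_ T₂ T₃ T₄ T₁
  ~*-rotate = rotate (triangleAdj-sym _ _)

  common-neighbour-unique : ∀ {u v x y} → u ~ v → u ~ x → v ~ x → u ~ y → v ~ y → x ≡ y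
  common-neighbour-unique u~v u~x v~x u~y v~y =
    let _ , _ , unique = proj₂ ll _ _ u~v in trans (unique _ u~x v~x) (sym (unique _ u~y v~y))

  third-vertex : ∀ {t x y} → IsTriangle t → x ∈△ t → y ∈△ t → x ≢ y → ∃[ z ] z ∈△ t × z ≢ x × z ≢ y
  third-vertex _                   first  first  x≢x = ⊥-elim (x≢x refl)
  third-vertex (p<q , q<r , _)     first  second _   = _ , third  , <⇒≢ (<-trans p<q q<r) ∘ sym , <⇒≢ q<r ∘ sym
  third-vertex (p<q , q<r , _)     first  third  _   = _ , second , <⇒≢ p<q ∘ sym , <⇒≢ q<r
  third-vertex (p<q , q<r , _)     second first  _   = _ , third  , <⇒≢ q<r ∘ sym , <⇒≢ (<-trans p<q q<r) ∘ sym
  third-vertex _                   second second x≢x = ⊥-elim (x≢x refl)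
  third-vertex (p<q , q<r , _)     second third  _   = _ , first  , <⇒≢ p<q , <⇒≢ (<-trans p<q q<r)
  third-vertex (p<q , q<r , _)     third  first  _   = _ , second , <⇒≢ q<r , <⇒≢ p<q ∘ sym
  third-vertex (p<q , q<r , _)     third  second _   = _ , first  , <⇒≢ (<-trans p<q q<r) , <⇒≢ p<q
  third-vertex _                   third  third  x≢x = ⊥-elim (x≢x refl)

  -- The third vertex of t and w are both common neighbours of the edge uv.
  ∈△-closed : ∀ {t u v w} → IsTriangle t → u ∈△ t → v ∈△ t → u ≢ v → u ~ w → v ~ w → w ∈△ t
  ∈△-closed t-tri u∈t v∈t u≢v u~w v~w =
    let z , z∈t , z≢u , z≢v = third-vertex t-tri u∈t v∈t u≢v
    in subst (_∈△ _) (common-neighbour-unique (∈△-adjacent t-tri u∈t v∈t u≢v)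
                        (∈△-adjacent t-tri u∈t z∈t (z≢u ∘ sym)) (∈△-adjacent t-tri v∈t z∈t (z≢v ∘ sym)) u~w v~w) z∈t

  sharing-edge⇒⊆ : ∀ {s s′ u v} → IsTriangle s → IsTriangle s′ → u ∈△ s → v ∈△ s → u ∈△ s′ → v ∈△ s′ → u ≢ v →
                   ∀ {x} → x ∈△ s → x ∈△ s′
  sharing-edge⇒⊆ {u = u} {v} s-tri s′-tri u∈s v∈s u∈s′ v∈s′ u≢v {x} x∈s with x ≟ᶠ u | x ≟ᶠ v
  ... | yes refl | _        = u∈s′
  ... | no _     | yes refl = v∈s′
  ... | no x≢u   | no x≢v   =
    ∈△-closed s′-tri u∈s′ v∈s′ u≢v (∈△-adjacent s-tri u∈s x∈s (x≢u ∘ sym)) (∈△-adjacent s-tri v∈s x∈s (x≢v ∘ sym))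

  triangles-sharing-edge : ∀ {s s′ u v} → IsTriangle s → IsTriangle s′ →
                           u ∈△ s → v ∈△ s → u ∈△ s′ → v ∈△ s′ → u ≢ v → s ≡ s′
  triangles-sharing-edge {_ , _ , _} {_ , _ , _} s-tri@(p<q , q<r , _) s′-tri@(p′<q′ , q′<r′ , _)
                         u∈s v∈s u∈s′ v∈s′ u≢v =
    increasing-triple-ext p<q q<r p′<q′ q′<r′ (sharing-edge⇒⊆ s-tri s′-tri u∈s v∈s u∈s′ v∈s′ u≢v)
                                              (sharing-edge⇒⊆ s′-tri s-tri u∈s′ v∈s′ u∈s v∈s u≢v)

  sharing-edge⇒≡ : ∀ {T U u v} → u ∈△ triangle T → v ∈△ triangle T → u ∈△ triangle U → v ∈△ triangle U →
                   u ≢ v → T ≡ U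
  sharing-edge⇒≡ {T} {U} u∈T v∈T u∈U v∈U u≢v =
    triangle-injective (triangles-sharing-edge (triangle-isTriangle T) (triangle-isTriangle U) u∈T v∈T u∈U v∈U u≢v)

  shared-vertex-unique : ∀ {T U x y} → T ≢ U →
                         x ∈△ triangle T → x ∈△ triangle U → y ∈△ triangle T → y ∈△ triangle U → x ≡ y
  shared-vertex-unique {x = x} {y} T≢U x∈T x∈U y∈T y∈U with x ≟ᶠ y
  ... | yes x≡y = x≡y
  ... | no  x≢y = ⊥-elim (T≢U (sharing-edge⇒≡ x∈T y∈T x∈U y∈U x≢y))

  increasing-arrangement : ∀ {u v w} → u ~ v → v ~ w → u ~ w → ∃[ t ] IsTriangle t × u ∈△ t × v ∈△ t
  increasing-arrangement {u} {v} {w} u~v v~w u~w with <-cmp u v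
  ... | tri≈ _ u≡v _ = ⊥-elim (adj⇒≢ G u~v u≡v)
  ... | tri< u<v _ _ with <-cmp v w
  ...   | tri< v<w _ _ = _ , (u<v , v<w , u~v , v~w , u~w) , first , second
  ...   | tri≈ _ v≡w _ = ⊥-elim (adj⇒≢ G v~w v≡w)
  ...   | tri> _ _ w<v with <-cmp u w
  ...     | tri< u<w _ _ = _ , (u<w , w<v , u~w , ~-sym v~w , u~v) , first , third
  ...     | tri≈ _ u≡w _ = ⊥-elim (adj⇒≢ G u~w u≡w)
  ...     | tri> _ _ w<u = _ , (w<u , u<v , ~-sym u~w , u~v , ~-sym v~w) , second , third
  increasing-arrangement {u} {v} {w} u~v v~w u~w | tri> _ _ v<u with <-cmp u w
  ...   | tri< u<w _ _ = _ , (v<u , u<w , ~-sym u~v , u~w , v~w) , second , first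
  ...   | tri≈ _ u≡w _ = ⊥-elim (adj⇒≢ G u~w u≡w)
  ...   | tri> _ _ w<u with <-cmp v w
  ...     | tri< v<w _ _ = _ , (v<w , w<u , v~w , ~-sym u~w , ~-sym u~v) , third , first
  ...     | tri≈ _ v≡w _ = ⊥-elim (adj⇒≢ G v~w v≡w)
  ...     | tri> _ _ w<v = _ , (w<v , v<u , ~-sym v~w , ~-sym u~v , ~-sym u~w) , third , second

  opaque
    edge-triangle : ∀ {u v} → u ~ v → ∃[ T ] u ∈△ triangle T × v ∈△ triangle T
    edge-triangle {u} {v} u~v =
      let w , (u~w , v~w) , _    = proj₂ ll u v u~v
          t , t-tri , u∈t , v∈t = increasing-arrangement u~v v~w u~w
          T , T≡t               = triangle-index t t-tri
      in T , subst (u ∈△_) (sym T≡t) u∈t , subst (v ∈△_) (sym T≡t) v∈t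

  no-shared-vertex : ∀ {T U x} → ¬ T ~* U → T ≢ U → x ∈△ triangle T → x ∈△ triangle U → ⊥
  no-shared-vertex T≁U T≢U x∈T x∈U = T≁U (triangleAdj-intro T≢U x∈T x∈U)

  cycleVertices : Tuple4 (Fin L) → Tuple4 V
  cycleVertices (T₁ , T₂ , T₃ , T₄) = (T₄ ∩ T₁ , T₁ ∩ T₂ , T₂ ∩ T₃ , T₃ ∩ T₄)

  module _ {T₁ T₂ T₃ T₄} (C : DirectedC4 _~*_ T₁ T₂ T₃ T₄) where
    open DirectedC4 C

    corner-∈ : T₄ ∩ T₁ ∈△ triangle T₁ × T₁ ∩ T₂ ∈△ triangle T₁
    corner-∈ = proj₂ (proj₂ (triangleAdj-elim d~a)) , proj₁ (proj₂ (triangleAdj-elim a~b))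

    corner-distinct : T₄ ∩ T₁ ≢ T₁ ∩ T₂
    corner-distinct eq = no-shared-vertex b≁d b≢d (subst (_∈△ triangle T₂) (sym eq) (proj₂ (proj₂ (triangleAdj-elim a~b))))
                                                  (proj₁ (proj₂ (triangleAdj-elim d~a)))

    corner-edge : T₄ ∩ T₁ ~ T₁ ∩ T₂
    corner-edge = ∈△-adjacent (triangle-isTriangle T₁) (proj₁ corner-∈) (proj₂ corner-∈) corner-distinct

  module _ {T₁ T₂ T₃ T₄} (C : DirectedC4 _~*_ T₁ T₂ T₃ T₄) where
    open DirectedC4 C

    diagonal-distinct : T₄ ∩ T₁ ≢ T₂ ∩ T₃
    diagonal-distinct eq = no-shared-vertex a≁c a≢c (proj₁ (corner-∈ C))
                                                    (subst (_∈△ triangle T₃) (sym eq) (proj₁ (corner-∈ (~*-rotate (~*-rotate C)))))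

    -- Otherwise T₄ ∩ T₁ is a common neighbour of the distinct vertices T₁ ∩ T₂, T₂ ∩ T₃ of T₂,
    -- so it lies in T₂ as well as in T₄.
    diagonal-nonadjacent : ¬ T₄ ∩ T₁ ~ T₂ ∩ T₃
    diagonal-nonadjacent adjacent = no-shared-vertex b≁d b≢d ∈T₂ (proj₁ (proj₂ (triangleAdj-elim d~a)))
      where
      C′ = ~*-rotate C
      ∈T₂ = ∈△-closed (triangle-isTriangle T₂) (proj₁ (corner-∈ C′)) (proj₂ (corner-∈ C′)) (corner-distinct C′)
                       (~-sym (corner-edge C)) (~-sym adjacent)

  cycleVertices-directedC4 : ∀ {T₁ T₂ T₃ T₄} → DirectedC4 _~*_ T₁ T₂ T₃ T₄ →
                             DirectedC4 _~_ (T₄ ∩ T₁) (T₁ ∩ T₂) (T₂ ∩ T₃) (T₃ ∩ T₄)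
  cycleVertices-directedC4 C = record
    { a~b = corner-edge C ; b~c = corner-edge C′ ; c~d = corner-edge C″ ; d~a = corner-edge C‴
    ; a≁c = diagonal-nonadjacent C ; b≁d = diagonal-nonadjacent C′
    ; a≢c = diagonal-distinct C ; b≢d = diagonal-distinct C′ }
    where
    C′  = ~*-rotate C
    C″  = ~*-rotate C′
    C‴  = ~*-rotate C″

  cycleVertices-injective₁ : ∀ {T₁ T₂ T₃ T₄ U₁ U₂ U₃ U₄} → DirectedC4 _~*_ T₁ T₂ T₃ T₄ → DirectedC4 _~*_ U₁ U₂ U₃ U₄ →
                             T₄ ∩ T₁ ≡ U₄ ∩ U₁ → T₁ ∩ T₂ ≡ U₁ ∩ U₂ → T₁ ≡ U₁
  cycleVertices-injective₁ C D eq₄₁ eq₁₂ =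
    sharing-edge⇒≡ (proj₁ (corner-∈ C)) (proj₂ (corner-∈ C))
                   (subst (_∈△ _) (sym eq₄₁) (proj₁ (corner-∈ D))) (subst (_∈△ _) (sym eq₁₂) (proj₂ (corner-∈ D)))
                   (corner-distinct C)

  cycleVertices-injective : ∀ {T₁ T₂ T₃ T₄ U₁ U₂ U₃ U₄} → DirectedC4 _~*_ T₁ T₂ T₃ T₄ → DirectedC4 _~*_ U₁ U₂ U₃ U₄ →
                            cycleVertices (T₁ , T₂ , T₃ , T₄) ≡ cycleVertices (U₁ , U₂ , U₃ , U₄) →
                            (T₁ , T₂ , T₃ , T₄) ≡ (U₁ , U₂ , U₃ , U₄)
  cycleVertices-injective C D eq =
    let e₄₁ , eq′ = ,-injective eq
        e₁₂ , eq″ = ,-injective eq′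
        e₂₃ , e₃₄ = ,-injective eq″
    in cong₂ _,_ (cycleVertices-injective₁ C D e₄₁ e₁₂)
      (cong₂ _,_ (cycleVertices-injective₁ (~*-rotate C) (~*-rotate D) e₁₂ e₂₃)
      (cong₂ _,_ (cycleVertices-injective₁ (~*-rotate (~*-rotate C)) (~*-rotate (~*-rotate D)) e₂₃ e₃₄)
                 (cycleVertices-injective₁ (~*-rotate (~*-rotate (~*-rotate C)))
                                           (~*-rotate (~*-rotate (~*-rotate D))) e₃₄ e₄₁)))

  edgeTriangle : ∀ {u v} → u ~ v → Fin L
  edgeTriangle u~v = proj₁ (edge-triangle u~v)

  module _ {a b c d} (C : DirectedC4 _~_ a b c d) where
    open DirectedC4 C
    private
      Tab = edgeTriangle a~b
      Tbc = edgeTriangle b~c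
      Tcd = edgeTriangle c~d
      a∈Tab = proj₁ (proj₂ (edge-triangle a~b))
      b∈Tab = proj₂ (proj₂ (edge-triangle a~b))
      b∈Tbc = proj₁ (proj₂ (edge-triangle b~c))
      c∈Tbc = proj₂ (proj₂ (edge-triangle b~c))
      c∈Tcd = proj₁ (proj₂ (edge-triangle c~d))
      d∈Tcd = proj₂ (proj₂ (edge-triangle c~d))

    consecutive-triangles : Tab ~* Tbc × Tab ∩ Tbc ≡ b
    consecutive-triangles = Tab~Tbc , shared-vertex-unique Tab≢Tbc ∩∈Tab ∩∈Tbc b∈Tab b∈Tbc
      where
      Tab≢Tbc : Tab ≢ Tbc
      Tab≢Tbc eq = a≁c (∈△-adjacent (triangle-isTriangle Tab) a∈Tab (subst (λ T → c ∈△ triangle T) (sym eq) c∈Tbc) a≢c)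
      Tab~Tbc = triangleAdj-intro Tab≢Tbc b∈Tab b∈Tbc
      ∩∈Tab = proj₁ (proj₂ (triangleAdj-elim Tab~Tbc))
      ∩∈Tbc = proj₂ (proj₂ (triangleAdj-elim Tab~Tbc))

    -- A common vertex y of Tab and Tcd is none of a, b, c, d (each case gives a diagonal edge),
    -- so a and c would be two common neighbours of the edge by.
    opposite-disjoint : ∀ {y} → y ∈△ triangle Tab → y ∈△ triangle Tcd → ⊥
    opposite-disjoint {y} y∈Tab y∈Tcd with y ≟ᶠ a | y ≟ᶠ b
    ... | yes refl | _        = a≁c (∈△-adjacent (triangle-isTriangle Tcd) y∈Tcd c∈Tcd a≢c)
    ... | no _     | yes refl = b≁d (∈△-adjacent (triangle-isTriangle Tcd) y∈Tcd d∈Tcd b≢d)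
    ... | no y≢a   | no y≢b with y ≟ᶠ c | y ≟ᶠ d
    ...   | yes refl | _        = a≁c (∈△-adjacent (triangle-isTriangle Tab) a∈Tab y∈Tab a≢c)
    ...   | no _     | yes refl = b≁d (∈△-adjacent (triangle-isTriangle Tab) b∈Tab y∈Tab b≢d)
    ...   | no y≢c   | no _     = a≢c (common-neighbour-unique b~y (~-sym a~b) y~a b~c y~c)
      where
      b~y = ∈△-adjacent (triangle-isTriangle Tab) b∈Tab y∈Tab (y≢b ∘ sym)
      y~a = ∈△-adjacent (triangle-isTriangle Tab) y∈Tab a∈Tab y≢a
      y~c = ∈△-adjacent (triangle-isTriangle Tcd) y∈Tcd c∈Tcd y≢c

    opposite-triangles : ¬ Tab ~* Tcd × Tab ≢ Tcd
    opposite-triangles = (λ Tab~Tcd → let _ , ∩∈Tab , ∩∈Tcd = triangleAdj-elim Tab~Tcd in opposite-disjoint ∩∈Tab ∩∈Tcd)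
                       , (λ eq → opposite-disjoint a∈Tab (subst (λ T → a ∈△ triangle T) eq a∈Tab))

  module _ {a b c d} (C : DirectedC4 _~_ a b c d) where
    open DirectedC4 C
    private
      C′ = ~-rotate C
      C″ = ~-rotate C′
      C‴ = ~-rotate C″

    edgeTriangles-directedC4 : DirectedC4 _~*_ (edgeTriangle a~b) (edgeTriangle b~c) (edgeTriangle c~d) (edgeTriangle d~a)
    edgeTriangles-directedC4 = record
      { a~b = proj₁ (consecutive-triangles C) ; b~c = proj₁ (consecutive-triangles C′)
      ; c~d = proj₁ (consecutive-triangles C″) ; d~a = proj₁ (consecutive-triangles C‴)
      ; a≁c = proj₁ (opposite-triangles C) ; b≁d = proj₁ (opposite-triangles C′)
      ; a≢c = proj₂ (opposite-triangles C) ; b≢d = proj₂ (opposite-triangles C′) }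

    cycleVertices-edgeTriangles :
      cycleVertices (edgeTriangle a~b , edgeTriangle b~c , edgeTriangle c~d , edgeTriangle d~a) ≡ (a , b , c , d)
    cycleVertices-edgeTriangles =
      cong₂ _,_ (proj₂ (consecutive-triangles C‴)) (cong₂ _,_ (proj₂ (consecutive-triangles C))
        (cong₂ _,_ (proj₂ (consecutive-triangles C′)) (proj₂ (consecutive-triangles C″))))

  numDirectedC4-triangleGraph : numDirectedC4 G ≡ numDirectedC4 (triangleGraph G)
  numDirectedC4-triangleGraph =
    count-bijection (tuples4-enumerates (allFin-enumerates (n G))) (tuples4-enumerates (allFin-enumerates L))
      (directedC4 G) (directedC4 (triangleGraph G)) cycleVertices
      (λ _ h → directedC4-complete G (cycleVertices-directedC4 (directedC4-sound (triangleGraph G) h)))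
      (λ _ h → let C = directedC4-sound G h
               in _ , directedC4-complete (triangleGraph G) (edgeTriangles-directedC4 C) , cycleVertices-edgeTriangles C)
      (λ _ _ h h′ → cycleVertices-injective (directedC4-sound (triangleGraph G) h) (directedC4-sound (triangleGraph G) h′))

proposition4 : (G : Graph) → LocallyLinear G →
    numInducedC4 (n G) (adj G) ≡ numInducedC4 (length (triangles G)) (triangleAdj G)
proposition4 G ll = ℕ.*-cancelˡ-≡ _ _ 8 (begin
  8 * numInducedC4 (n G) (adj G)                          ≡⟨ sym (numDirectedC4≡8*numInducedC4 G) ⟩
  numDirectedC4 G                                         ≡⟨ LocallyLinearTriangles.numDirectedC4-triangleGraph G ll ⟩
  numDirectedC4 (triangleGraph G)                         ≡⟨ numDirectedC4≡8*numInducedC4 (triangleGraph G) ⟩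
  8 * numInducedC4 (length (triangles G)) (triangleAdj G) ∎)
  where open ≡-Reasoning
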